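{- Let $\Delta$ be a stack triangulation with at least $4$ vertices, whose outer triangle is ordered as $(v_1,v_2,v_3)$, and let $u$ be the vertex inserted by the first application of the growing rule in a construction of $\Delta$ (so $u$ lies inside the outer triangle and is adjacent to $v_1,v_2,v_3$). Let $\Delta^1,\Delta^2,\Delta^3$ be the stack triangulations induced by the vertices of $\Delta$ lying on or inside the triangles $v_1v_2u$, $v_2v_3u$, $v_3v_1u$ respectively, with ordered outer triangles $(v_1,v_2,u)$, $(v_2,v_3,u)$, $(v_3,v_1,u)$ respectively. Write the degeneracy vector of $\Delta^j$ as $(v_j^0,v_j^1,v_j^2,v_j^3)$ for $j=1,2,3$. Then the degeneracy vector of $\Delta$ is \[ \begin{pmatrix} v_1^0v_2^0v_3^0+v_1^1v_2^1v_3^1\\ v_1^0v_2^2v_3^3+v_1^1v_2^3v_3^2\\ v_1^2v_2^3v_3^0+v_1^3v_2^2v_3^1\\ v_1^2v_2^1v_3^3+v_1^3v_2^0v_3^2 \end{pmatrix}. \]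
   Context: A stack triangulation is a plane graph obtained by starting with a triangle drawn in the plane and repeatedly applying the growing rule: choose a bounded face $f$ of the current plane triangulation, insert a new vertex in the interior of $f$, and join it to the three vertices on the boundary of $f$. A state (spin assignment) of a graph with vertex set $V$ is a map $s:V\to\{+,-\}$ (i.e. $\{1,-1\}$); an edge $\{x,y\}$ is frustrated if $s(x)=s(y)$. A state of a stack triangulation is satisfying if every bounded face (triangle) has exactly one frustrated edge on its boundary (for a single triangle, the bounded face is the triangle itself). For a stack triangulation $\Delta$ with ordered outer triangle $(a,b,c)$, its degeneracy vector is $\mathbf{v}_\Delta=(\Delta[+{+}+],\Delta[+{+}-],\Delta[+{ - }+],\Delta[-{+}+])\in\mathbb{R}^4$, with coordinates indexed $0,1,2,3$ in this order, where $\Delta[\phi]$ is the number of satisfying states $s$ with $(s(a),s(b),s(c))=\phi$. (For example a single triangle has degeneracy vector $(0,1,1,1)$.) -}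

module Defs where

open import Data.Nat using (ℕ; zero; suc; _+_)
open import Data.Fin using (Fin; zero; suc; _↑ˡ_; _↑ʳ_; #_)
open import Data.Vec using (Vec; []; _∷_; lookup)
open import Data.List using (List; []; _∷_; _++_; map; length; filterᵇ)
open import Data.Bool using (Bool; true; false; _∧_)
open import Data.Product using (_×_; _,_)

-- Combinatorial description of a stack triangulation via its construction:
-- `triangle` is a single triangle; `grow Δ¹ Δ² Δ³` is obtained by inserting a
-- vertex u into the outer triangle (v1,v2,v3) and then growing, independently,
-- the stack triangulations Δ¹, Δ², Δ³ inside the triangles
-- (v1,v2,u), (v2,v3,u), (v3,v1,u) respectively (with those ordered outer triangles).
data Stack : Set where
  triangle : Stack
  grow     : Stack → Stack → Stack → Stack

inner : Stack → ℕ
inner triangle       = 0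
inner (grow a b c)   = suc (inner a + inner b + inner c)

-- number of vertices: outer vertices are 0,1,2 (= v1,v2,v3), inner ones 3,4,...
nV : Stack → ℕ
nV T = 3 + inner T

Face : ℕ → Set
Face n = Fin n × Fin n × Fin n

-- bounded faces of a stack triangulation T whose outer triangle is (a,b,c),
-- with inner vertices labelled by e
facesAux : ∀ {n} (T : Stack) → (Fin (inner T) → Fin n) → Fin n → Fin n → Fin n → List (Face n)
facesAux triangle e a b c = (a , b , c) ∷ []
facesAux (grow t1 t2 t3) e a b c =
     facesAux t1 (λ i → e (suc ((i ↑ˡ inner t2) ↑ˡ inner t3))) a b u
  ++ facesAux t2 (λ i → e (suc ((inner t1 ↑ʳ i) ↑ˡ inner t3))) b c u
  ++ facesAux t3 (λ i → e (suc ((inner t1 + inner t2) ↑ʳ i))) c a u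
  where
  u = e zero

v₁ v₂ v₃ : (T : Stack) → Fin (nV T)
v₁ T = zero
v₂ T = suc zero
v₃ T = suc (suc zero)

faces : (T : Stack) → List (Face (nV T))
faces T = facesAux T (3 ↑ʳ_) (v₁ T) (v₂ T) (v₃ T)

-- spins: true = +, false = -
_==_ : Bool → Bool → Bool
true  == true  = true
false == false = true
_     == _     = false

State : ℕ → Set
State n = Vec Bool n

frustrated : ∀ {n} → State n → Fin n → Fin n → Bool
frustrated s x y = lookup s x == lookup s y

count3 : Bool → Bool → Bool → ℕ
count3 p q r = b p + b q + b r
  where
  b : Bool → ℕ
  b true  = 1
  b false = 0

isOne : ℕ → Bool
isOne (suc zero) = true
isOne _          = false

allB : ∀ {A : Set} → (A → Bool) → List A → Bool
allB p []       = true
allB p (x ∷ xs) = p x ∧ allB p xs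

satisfying : (T : Stack) → State (nV T) → Bool
satisfying T s = allB ok (faces T)
  where
  ok : Face (nV T) → Bool
  ok (x , y , z) = isOne (count3 (frustrated s x y) (frustrated s y z) (frustrated s z x))

allStates : (n : ℕ) → List (State n)
allStates zero    = [] ∷ []
allStates (suc n) = map (true ∷_) (allStates n) ++ map (false ∷_) (allStates n)

degCount : Stack → Bool → Bool → Bool → ℕ
degCount T p q r =
  length (filterᵇ (λ s → satisfying T s ∧ (lookup s (v₁ T) == p)
                                       ∧ (lookup s (v₂ T) == q)
                                       ∧ (lookup s (v₃ T) == r))
                  (allStates (nV T)))

-- degeneracy vector (Δ[+++], Δ[++-], Δ[+-+], Δ[-++])
degVec : Stack → Vec ℕ 4
degVec T = degCount T true true true ∷ degCount T true true false
         ∷ degCount T true false true ∷ degCount T false true true ∷ []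

-- Every bounded face of grow Δ¹ Δ² Δ³ lies in exactly one of the three sub-triangulations, so once
-- the spins of v₁, v₂, v₃ and of the new vertex u are fixed, the satisfying states factor into
-- independent satisfying states of Δ¹, Δ², Δ³: the count for each spin of u is a product of
-- three degeneracies, and the entry of degVec is the sum over the two spins of u.  A global spin
-- flip preserves satisfying states, so Δ[φ] = Δ[-φ]; this brings every factor to one of the four
-- coordinates of the degeneracy vectors.
module Submission where

open import Defs
open import Data.Nat using (ℕ; _+_; _*_; zero; suc)
open import Data.Nat.Properties using (+-identityʳ; *-distribˡ-+; *-distribʳ-+; +-comm)
open import Data.Fin using (Fin; #_; zero; suc; _↑ˡ_; _↑ʳ_)
open import Data.Vec using ([]; _∷_; lookup; _++_) renaming (map to mapᵥ)
open import Data.Vec.Properties using (lookup-++ˡ; lookup-++ʳ; lookup-map)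
open import Data.List using (List; []; _∷_; map; length; filterᵇ) renaming (_++_ to _++ₗ_)
open import Data.List.Properties using (length-++; filter-++)
open import Data.Bool using (Bool; true; false; _∧_; not; T?)
open import Data.Bool.Properties using (∧-assoc; ∧-comm; ∧-identityʳ)
open import Data.Product using (_,_)
open import Function using (_∘_)
open import Relation.Binary.PropositionalEquality
  using (_≡_; refl; sym; trans; cong; cong₂; module ≡-Reasoning)

indicator : Bool → ℕ
indicator true  = 1
indicator false = 0

indicator-∧ : ∀ a b → indicator (a ∧ b) ≡ indicator a * indicator b
indicator-∧ true  b = sym (+-identityʳ (indicator b))
indicator-∧ false b = refl

==-not : ∀ x y → (not x == not y) ≡ (x == y)
==-not true  true  = refl
==-not true  false = refl
==-not false true  = refl
==-not false false = refl

sumStates : (n : ℕ) → (State n → ℕ) → ℕ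
sumStates zero    f = f []
sumStates (suc n) f = sumStates n (f ∘ (true ∷_)) + sumStates n (f ∘ (false ∷_))

sumStates-cong : ∀ n {f g : State n → ℕ} → (∀ s → f s ≡ g s) → sumStates n f ≡ sumStates n g
sumStates-cong zero    f≗g = f≗g []
sumStates-cong (suc n) f≗g =
  cong₂ _+_ (sumStates-cong n (f≗g ∘ (true ∷_))) (sumStates-cong n (f≗g ∘ (false ∷_)))

sumStates-zero : ∀ n → sumStates n (λ _ → 0) ≡ 0
sumStates-zero zero    = refl
sumStates-zero (suc n) = cong₂ _+_ (sumStates-zero n) (sumStates-zero n)

sumStates-*ˡ : ∀ n k (f : State n → ℕ) → sumStates n (λ s → k * f s) ≡ k * sumStates n f
sumStates-*ˡ zero    k f = refl
sumStates-*ˡ (suc n) k f = trans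
  (cong₂ _+_ (sumStates-*ˡ n k (f ∘ (true ∷_))) (sumStates-*ˡ n k (f ∘ (false ∷_))))
  (sym (*-distribˡ-+ k (sumStates n (f ∘ (true ∷_))) (sumStates n (f ∘ (false ∷_)))))

sumStates-*ʳ : ∀ n k (f : State n → ℕ) → sumStates n (λ s → f s * k) ≡ sumStates n f * k
sumStates-*ʳ zero    k f = refl
sumStates-*ʳ (suc n) k f = trans
  (cong₂ _+_ (sumStates-*ʳ n k (f ∘ (true ∷_))) (sumStates-*ʳ n k (f ∘ (false ∷_))))
  (sym (*-distribʳ-+ k (sumStates n (f ∘ (true ∷_))) (sumStates n (f ∘ (false ∷_)))))

sumStates-* : ∀ m n (f : State m → ℕ) (g : State n → ℕ) →
  sumStates m (λ r → sumStates n (λ s → f r * g s)) ≡ sumStates m f * sumStates n g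
sumStates-* m n f g = trans
  (sumStates-cong m (λ r → sumStates-*ˡ n (f r) g))
  (sumStates-*ʳ m (sumStates n g) f)

sumStates-*₃ : ∀ l m n (f : State l → ℕ) (g : State m → ℕ) (h : State n → ℕ) →
  sumStates l (λ q → sumStates m (λ r → sumStates n (λ s → f q * g r * h s)))
    ≡ sumStates l f * sumStates m g * sumStates n h
sumStates-*₃ l m n f g h = trans
  (sumStates-cong l (λ q → sumStates-* m n (λ r → f q * g r) h))
  (trans (sumStates-*ʳ l (sumStates n h) (λ q → sumStates m (λ r → f q * g r)))
         (cong (_* sumStates n h) (sumStates-* l m f g)))

sumStates-++ : ∀ m n (f : State (m + n) → ℕ) →
  sumStates (m + n) f ≡ sumStates m (λ r → sumStates n (λ s → f (r ++ s)))
sumStates-++ zero    n f = refl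
sumStates-++ (suc m) n f = cong₂ _+_ (sumStates-++ m n _) (sumStates-++ m n _)

sumStates-map-not : ∀ n (f : State n → ℕ) → sumStates n (f ∘ mapᵥ not) ≡ sumStates n f
sumStates-map-not zero    f = refl
sumStates-map-not (suc n) f = trans
  (cong₂ _+_ (sumStates-map-not n (f ∘ (false ∷_))) (sumStates-map-not n (f ∘ (true ∷_))))
  (+-comm (sumStates n (f ∘ (false ∷_))) (sumStates n (f ∘ (true ∷_))))

sumStates-select : ∀ n x (p : State (suc n) → Bool) →
  sumStates (suc n) (λ s → indicator ((lookup s zero == x) ∧ p s))
    ≡ sumStates n (λ s → indicator (p (x ∷ s)))
sumStates-select n true  p =
  trans (cong (sumStates n (indicator ∘ p ∘ (true ∷_)) +_) (sumStates-zero n)) (+-identityʳ _)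
sumStates-select n false p = cong (_+ sumStates n (indicator ∘ p ∘ (false ∷_))) (sumStates-zero n)

length-filterᵇ-map : ∀ {A B : Set} (p : B → Bool) (f : A → B) (xs : List A) →
  length (filterᵇ p (map f xs)) ≡ length (filterᵇ (p ∘ f) xs)
length-filterᵇ-map p f []       = refl
length-filterᵇ-map p f (x ∷ xs) with p (f x)
... | true  = cong suc (length-filterᵇ-map p f xs)
... | false = length-filterᵇ-map p f xs

length-filterᵇ-allStates : ∀ n (p : State n → Bool) →
  length (filterᵇ p (allStates n)) ≡ sumStates n (indicator ∘ p)
length-filterᵇ-allStates zero    p with p []
... | true  = refl
... | false = refl
length-filterᵇ-allStates (suc n) p = begin
  length (filterᵇ p (map (true ∷_) states ++ₗ map (false ∷_) states))
    ≡⟨ cong length (filter-++ (T? ∘ p) (map (true ∷_) states) _) ⟩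
  length (filterᵇ p (map (true ∷_) states) ++ₗ filterᵇ p (map (false ∷_) states))
    ≡⟨ length-++ (filterᵇ p (map (true ∷_) states)) ⟩
  length (filterᵇ p (map (true ∷_) states)) + length (filterᵇ p (map (false ∷_) states))
    ≡⟨ cong₂ _+_ (trans (length-filterᵇ-map p _ states) (length-filterᵇ-allStates n _))
                 (trans (length-filterᵇ-map p _ states) (length-filterᵇ-allStates n _)) ⟩
  sumStates (suc n) (indicator ∘ p) ∎
  where
  open ≡-Reasoning
  states : List (State n)
  states = allStates n

exactlyOneFrustrated : Bool → Bool → Bool → Bool
exactlyOneFrustrated x y z = isOne (count3 (x == y) (y == z) (z == x))

-- Satisfaction of T read off the spins alone: σ gives the spins of the inner vertices (in the
-- order of facesAux) and x, y, z those of the outer triangle.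
satisfiedBy : (T : Stack) → (Fin (inner T) → Bool) → Bool → Bool → Bool → Bool
satisfiedBy triangle        σ x y z = exactlyOneFrustrated x y z
satisfiedBy (grow t₁ t₂ t₃) σ x y z =
     satisfiedBy t₁ (λ i → σ (suc ((i ↑ˡ inner t₂) ↑ˡ inner t₃))) x y u
   ∧ (satisfiedBy t₂ (λ i → σ (suc ((inner t₁ ↑ʳ i) ↑ˡ inner t₃))) y z u
   ∧ satisfiedBy t₃ (λ i → σ (suc ((inner t₁ + inner t₂) ↑ʳ i))) z x u)
  where
  u : Bool
  u = σ zero

satisfiedBy-cong : ∀ T {σ τ : Fin (inner T) → Bool} → (∀ i → σ i ≡ τ i) →
  ∀ x y z → satisfiedBy T σ x y z ≡ satisfiedBy T τ x y z
satisfiedBy-cong triangle        σ≗τ x y z = refl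
satisfiedBy-cong (grow t₁ t₂ t₃) σ≗τ x y z rewrite σ≗τ zero =
  cong₂ _∧_ (satisfiedBy-cong t₁ (σ≗τ ∘ _) x y _)
    (cong₂ _∧_ (satisfiedBy-cong t₂ (σ≗τ ∘ _) y z _) (satisfiedBy-cong t₃ (σ≗τ ∘ _) z x _))

satisfiedBy-not : ∀ T (σ : Fin (inner T) → Bool) x y z →
  satisfiedBy T (not ∘ σ) (not x) (not y) (not z) ≡ satisfiedBy T σ x y z
satisfiedBy-not triangle σ x y z rewrite ==-not x y | ==-not y z | ==-not z x = refl
satisfiedBy-not (grow t₁ t₂ t₃) σ x y z =
  cong₂ _∧_ (satisfiedBy-not t₁ _ x y _)
    (cong₂ _∧_ (satisfiedBy-not t₂ _ y z _) (satisfiedBy-not t₃ _ z x _))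

allB-++ : ∀ {A : Set} (p : A → Bool) xs ys → allB p (xs ++ₗ ys) ≡ allB p xs ∧ allB p ys
allB-++ p []       ys = refl
allB-++ p (x ∷ xs) ys = trans (cong (p x ∧_) (allB-++ p xs ys)) (sym (∧-assoc (p x) _ _))

allB-facesAux : ∀ T {n} (e : Fin (inner T) → Fin n) a b c (s : State n) →
  allB (λ { (x , y , z) → exactlyOneFrustrated (lookup s x) (lookup s y) (lookup s z) })
       (facesAux T e a b c)
    ≡ satisfiedBy T (lookup s ∘ e) (lookup s a) (lookup s b) (lookup s c)
allB-facesAux triangle        e a b c s = ∧-identityʳ _
allB-facesAux (grow t₁ t₂ t₃) e a b c s =
  trans (allB-++ _ (facesAux t₁ _ a b _) _)
    (cong₂ _∧_ (allB-facesAux t₁ _ a b _ s)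
      (trans (allB-++ _ (facesAux t₂ _ b c _) _)
        (cong₂ _∧_ (allB-facesAux t₂ _ b c _ s) (allB-facesAux t₃ _ c a _ s))))

satisfying≡satisfiedBy : ∀ T x y z (r : State (inner T)) →
  satisfying T (x ∷ y ∷ z ∷ r) ≡ satisfiedBy T (lookup r) x y z
satisfying≡satisfiedBy T x y z r =
  allB-facesAux T (3 ↑ʳ_) zero (suc zero) (suc (suc zero)) (x ∷ y ∷ z ∷ r)

extensions : Stack → Bool → Bool → Bool → ℕ
extensions T x y z = sumStates (inner T) (λ r → indicator (satisfiedBy T (lookup r) x y z))

degCount≡extensions : ∀ T x y z → degCount T x y z ≡ extensions T x y z
degCount≡extensions T x y z = begin
  degCount T x y z
    ≡⟨ length-filterᵇ-allStates (nV T) _ ⟩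
  sumStates (nV T) (λ s → indicator (satisfying T s ∧ (v₁= s ∧ (v₂= s ∧ v₃= s))))
    ≡⟨ sumStates-cong (nV T) (cong indicator ∘ satisfying-last) ⟩
  sumStates (nV T) (λ s → indicator (v₁= s ∧ (v₂= s ∧ (v₃= s ∧ satisfying T s))))
    ≡⟨ sumStates-select (2 + inner T) x (λ s → v₂= s ∧ (v₃= s ∧ satisfying T s)) ⟩
  sumStates (2 + inner T) (λ s → indicator (v₂= (x ∷ s) ∧ (v₃= (x ∷ s) ∧ satisfying T (x ∷ s))))
    ≡⟨ sumStates-select (1 + inner T) y (λ s → v₃= (x ∷ s) ∧ satisfying T (x ∷ s)) ⟩
  sumStates (1 + inner T) (λ s → indicator (v₃= (x ∷ y ∷ s) ∧ satisfying T (x ∷ y ∷ s)))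
    ≡⟨ sumStates-select (inner T) z (λ s → satisfying T (x ∷ y ∷ s)) ⟩
  sumStates (inner T) (λ r → indicator (satisfying T (x ∷ y ∷ z ∷ r)))
    ≡⟨ sumStates-cong (inner T) (cong indicator ∘ satisfying≡satisfiedBy T x y z) ⟩
  extensions T x y z ∎
  where
  open ≡-Reasoning
  v₁= v₂= v₃= : State (nV T) → Bool
  v₁= s = lookup s (v₁ T) == x
  v₂= s = lookup s (v₂ T) == y
  v₃= s = lookup s (v₃ T) == z
  satisfying-last : ∀ s → satisfying T s ∧ (v₁= s ∧ (v₂= s ∧ v₃= s))
                        ≡ v₁= s ∧ (v₂= s ∧ (v₃= s ∧ satisfying T s))
  satisfying-last s = trans (∧-comm (satisfying T s) _)
    (trans (∧-assoc (v₁= s) _ _) (cong (v₁= s ∧_) (∧-assoc (v₂= s) _ _)))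

extensions-not : ∀ T x y z → extensions T x y z ≡ extensions T (not x) (not y) (not z)
extensions-not T x y z = begin
  extensions T x y z
    ≡⟨ sumStates-cong (inner T) (λ r → cong indicator (sym (trans
         (satisfiedBy-cong T (λ i → lookup-map i not r) _ _ _) (satisfiedBy-not T (lookup r) x y z)))) ⟩
  sumStates (inner T) (λ r → indicator (satisfiedBy T (lookup (mapᵥ not r)) (not x) (not y) (not z)))
    ≡⟨ sumStates-map-not (inner T) _ ⟩
  extensions T (not x) (not y) (not z) ∎
  where open ≡-Reasoning

degCount-not : ∀ T x y z → degCount T x y z ≡ degCount T (not x) (not y) (not z)
degCount-not T x y z = trans (degCount≡extensions T x y z)
  (trans (extensions-not T x y z) (sym (degCount≡extensions T _ _ _)))

indicator-satisfiedBy-grow : ∀ t₁ t₂ t₃ x y z u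
  (r₁ : State (inner t₁)) (r₂ : State (inner t₂)) (r₃ : State (inner t₃)) →
  indicator (satisfiedBy (grow t₁ t₂ t₃) (lookup (u ∷ (r₁ ++ r₂) ++ r₃)) x y z)
    ≡ indicator (satisfiedBy t₁ (lookup r₁) x y u)
    * indicator (satisfiedBy t₂ (lookup r₂) y z u)
    * indicator (satisfiedBy t₃ (lookup r₃) z x u)
indicator-satisfiedBy-grow t₁ t₂ t₃ x y z u r₁ r₂ r₃ = begin
  indicator (A ∧ (B ∧ C))               ≡⟨ cong indicator (sym (∧-assoc A B C)) ⟩
  indicator ((A ∧ B) ∧ C)               ≡⟨ indicator-∧ (A ∧ B) C ⟩
  indicator (A ∧ B) * indicator C       ≡⟨ cong (_* indicator C) (indicator-∧ A B) ⟩
  indicator A * indicator B * indicator C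
    ≡⟨ cong₂ _*_ (cong₂ _*_
         (cong indicator (satisfiedBy-cong t₁ (λ i →
           trans (lookup-++ˡ (r₁ ++ r₂) r₃ (i ↑ˡ n₂)) (lookup-++ˡ r₁ r₂ i)) x y u))
         (cong indicator (satisfiedBy-cong t₂ (λ i →
           trans (lookup-++ˡ (r₁ ++ r₂) r₃ (n₁ ↑ʳ i)) (lookup-++ʳ r₁ r₂ i)) y z u)))
         (cong indicator (satisfiedBy-cong t₃ (lookup-++ʳ (r₁ ++ r₂) r₃) z x u)) ⟩
  indicator (satisfiedBy t₁ (lookup r₁) x y u)
    * indicator (satisfiedBy t₂ (lookup r₂) y z u)
    * indicator (satisfiedBy t₃ (lookup r₃) z x u) ∎
  where
  open ≡-Reasoning
  n₁ n₂ n₃ : ℕ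
  n₁ = inner t₁
  n₂ = inner t₂
  n₃ = inner t₃
  r : State (n₁ + n₂ + n₃)
  r = (r₁ ++ r₂) ++ r₃
  A B C : Bool
  A = satisfiedBy t₁ (λ i → lookup r ((i ↑ˡ n₂) ↑ˡ n₃)) x y u
  B = satisfiedBy t₂ (λ i → lookup r ((n₁ ↑ʳ i) ↑ˡ n₃)) y z u
  C = satisfiedBy t₃ (λ i → lookup r ((n₁ + n₂) ↑ʳ i)) z x u

extensions-grow : ∀ t₁ t₂ t₃ x y z u →
  sumStates (inner t₁ + inner t₂ + inner t₃)
    (λ r → indicator (satisfiedBy (grow t₁ t₂ t₃) (lookup (u ∷ r)) x y z))
    ≡ extensions t₁ x y u * extensions t₂ y z u * extensions t₃ z x u
extensions-grow t₁ t₂ t₃ x y z u = begin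
  sumStates (n₁ + n₂ + n₃) (λ r → indicator (satisfiedBy (grow t₁ t₂ t₃) (lookup (u ∷ r)) x y z))
    ≡⟨ sumStates-++ (n₁ + n₂) n₃ _ ⟩
  sumStates (n₁ + n₂) (λ r₁₂ → sumStates n₃ (λ r₃ →
    indicator (satisfiedBy (grow t₁ t₂ t₃) (lookup (u ∷ r₁₂ ++ r₃)) x y z)))
    ≡⟨ sumStates-++ n₁ n₂ _ ⟩
  sumStates n₁ (λ r₁ → sumStates n₂ (λ r₂ → sumStates n₃ (λ r₃ →
    indicator (satisfiedBy (grow t₁ t₂ t₃) (lookup (u ∷ (r₁ ++ r₂) ++ r₃)) x y z))))
    ≡⟨ sumStates-cong n₁ (λ r₁ → sumStates-cong n₂ (λ r₂ → sumStates-cong n₃ (λ r₃ →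
         indicator-satisfiedBy-grow t₁ t₂ t₃ x y z u r₁ r₂ r₃))) ⟩
  sumStates n₁ (λ r₁ → sumStates n₂ (λ r₂ → sumStates n₃ (λ r₃ →
    indicator (satisfiedBy t₁ (lookup r₁) x y u)
      * indicator (satisfiedBy t₂ (lookup r₂) y z u)
      * indicator (satisfiedBy t₃ (lookup r₃) z x u))))
    ≡⟨ sumStates-*₃ n₁ n₂ n₃ _ _ _ ⟩
  extensions t₁ x y u * extensions t₂ y z u * extensions t₃ z x u ∎
  where
  open ≡-Reasoning
  n₁ n₂ n₃ : ℕ
  n₁ = inner t₁
  n₂ = inner t₂
  n₃ = inner t₃

degCount-grow : ∀ t₁ t₂ t₃ x y z → degCount (grow t₁ t₂ t₃) x y z ≡
    degCount t₁ x y true  * degCount t₂ y z true  * degCount t₃ z x true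
  + degCount t₁ x y false * degCount t₂ y z false * degCount t₃ z x false
degCount-grow t₁ t₂ t₃ x y z = begin
  degCount (grow t₁ t₂ t₃) x y z
    ≡⟨ degCount≡extensions (grow t₁ t₂ t₃) x y z ⟩
  extensions (grow t₁ t₂ t₃) x y z
    ≡⟨ cong₂ _+_ (extensions-grow t₁ t₂ t₃ x y z true) (extensions-grow t₁ t₂ t₃ x y z false) ⟩
    extensions t₁ x y true  * extensions t₂ y z true  * extensions t₃ z x true
  + extensions t₁ x y false * extensions t₂ y z false * extensions t₃ z x false
    ≡⟨ sym (cong₂ _+_ (product true) (product false)) ⟩
    degCount t₁ x y true  * degCount t₂ y z true  * degCount t₃ z x true
  + degCount t₁ x y false * degCount t₂ y z false * degCount t₃ z x false ∎
  where
  open ≡-Reasoning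
  product : ∀ u → degCount t₁ x y u * degCount t₂ y z u * degCount t₃ z x u
                ≡ extensions t₁ x y u * extensions t₂ y z u * extensions t₃ z x u
  product u = cong₂ _*_ (cong₂ _*_ (degCount≡extensions t₁ x y u) (degCount≡extensions t₂ y z u))
                        (degCount≡extensions t₃ z x u)

proposition5 : (Δ¹ Δ² Δ³ : Stack) →
    let a = lookup (degVec Δ¹)
        b = lookup (degVec Δ²)
        c = lookup (degVec Δ³)
    in degVec (grow Δ¹ Δ² Δ³) ≡
         (a (# 0) * b (# 0) * c (# 0) + a (# 1) * b (# 1) * c (# 1))
       ∷ (a (# 0) * b (# 2) * c (# 3) + a (# 1) * b (# 3) * c (# 2))
       ∷ (a (# 2) * b (# 3) * c (# 0) + a (# 3) * b (# 2) * c (# 1))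
       ∷ (a (# 2) * b (# 1) * c (# 3) + a (# 3) * b (# 0) * c (# 2))
       ∷ []
proposition5 Δ¹ Δ² Δ³ =
  cong₂ _∷_ (degCount-grow Δ¹ Δ² Δ³ true true true)
  (cong₂ _∷_ (trans (degCount-grow Δ¹ Δ² Δ³ true true false)
    (cong (a true true true * b true false true * c false true true +_)
      (cong₂ _*_ (cong (a true true false *_) (degCount-not Δ² true false false))
                 (degCount-not Δ³ false true false))))
  (cong₂ _∷_ (trans (degCount-grow Δ¹ Δ² Δ³ true false true)
    (cong (a true false true * b false true true * c true true true +_)
      (cong (_* c true true false)
        (cong₂ _*_ (degCount-not Δ¹ true false false) (degCount-not Δ² false true false)))))
  (cong₂ _∷_ (trans (degCount-grow Δ¹ Δ² Δ³ false true true)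
    (trans (+-comm (a false true true * b true true true * c true false true) _)
      (cong (_+ a false true true * b true true true * c true false true)
        (cong₂ _*_ (cong (_* b true true false) (degCount-not Δ¹ false true false))
                   (degCount-not Δ³ true false false)))))
  refl)))
  where
  a b c : Bool → Bool → Bool → ℕ
  a = degCount Δ¹
  b = degCount Δ²
  c = degCount Δ³
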